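{- Let $K(v)$ be a complete multipartite graph, $E$ a set of edges of $K(v)$, and $E_1 \subseteq E$. Suppose $E_1$ has at most $N$ subsets that are continuable outside of $E_1$. Then the number of garlands is at most $N\cdot 2^{|E| - |E_1|} - 1$.
   Context: All graphs are finite and simple. For a sequence $v=(v_1,\dots,v_t)$ of positive integers, $K(v)$ is the complete $t$-partite graph with parts $V_1,\dots,V_t$, $|V_i|=v_i$. An $E$-subgraph is a subgraph $G_1$ of $K(v)$ which is a complete multipartite graph (with at least two nonempty parts) such that every part of $G_1$ is contained in some part of $K(v)$ and every edge of $G_1$ belongs to $E$. A garland is a nonempty set of pairwise vertex-disjoint $E$-subgraphs; its edge aggregate is the union of the edge sets of its $E$-subgraphs. A subset $E_2 \subseteq E_1$ is continuable outside of $E_1$ if there is a garland with edge aggregate $E'$ such that $E_2 = E' \cap E_1$; by convention the empty set is regarded as continuable. -}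

module Defs where

open import Data.Nat using (ℕ; _+_; _*_; _∸_; _^_; _≤_; _<_; _<ᵇ_)
open import Data.Bool using (Bool; true; false; _∧_; _∨_; if_then_else_)
open import Data.Fin using (Fin; toℕ; zero; suc; _≟_)
open import Data.Vec using (Vec; lookup)
open import Data.List using (List; []; _∷_; length)
open import Data.List.Membership.Propositional using (_∈_)
open import Data.List.Relation.Unary.All using (All)
open import Data.List.Relation.Unary.AllPairs using (AllPairs)
open import Data.List.Relation.Unary.Unique.Propositional using (Unique)
open import Data.Product using (Σ; ∃; _×_; _,_)
open import Relation.Nullary using (¬_)
open import Relation.Nullary.Decidable using (isYes)
open import Data.Empty using (⊥)
open import Data.Sum using (_⊎_)
open import Relation.Binary.PropositionalEquality using (_≡_; _≢_)

countFin : (n : ℕ) → (Fin n → Bool) → ℕ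
countFin ℕ.zero    p = 0
countFin (ℕ.suc n) p = (if p zero then 1 else 0) + countFin n (λ i → p (suc i))

-- a vertex subset (characteristic vector; canonical, so ≡ is set equality)
VSet : ℕ → Set
VSet n = Vec Bool n

_∈ᵥ_ : ∀ {n} → Fin n → VSet n → Set
w ∈ᵥ W = lookup W w ≡ true

EdgeSet : ℕ → Set
EdgeSet n = Vec (Vec Bool n) n

_⟪_,_⟫ : ∀ {n} → EdgeSet n → Fin n → Fin n → Bool
M ⟪ i , j ⟫ = lookup (lookup M i) j

Symmetric : ∀ {n} → EdgeSet n → Set
Symmetric {n} M = (i j : Fin n) → M ⟪ i , j ⟫ ≡ M ⟪ j , i ⟫

_⊆ₑ_ : ∀ {n} → EdgeSet n → EdgeSet n → Set
_⊆ₑ_ {n} A B = (i j : Fin n) → A ⟪ i , j ⟫ ≡ true → B ⟪ i , j ⟫ ≡ true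

sumFin : (n : ℕ) → (Fin n → ℕ) → ℕ
sumFin ℕ.zero    f = 0
sumFin (ℕ.suc n) f = f zero + sumFin n (λ i → f (suc i))

∣_∣ₑ : ∀ {n} → EdgeSet n → ℕ
∣_∣ₑ {n} M = sumFin n (λ i → countFin n (λ j → (toℕ i <ᵇ toℕ j) ∧ (M ⟪ i , j ⟫)))

-- The complete multipartite graph K(v), v = (v_1,…,v_t), v_i ≥ 1.
-- Its vertex set is Fin n, and c : Fin n → Fin t says which part V_i a
-- vertex lies in; |V_i| = v i.

IsKv : (t : ℕ) (v : Fin t → ℕ) (n : ℕ) (c : Fin n → Fin t) → Set
IsKv t v n c = (i : Fin t) → (1 ≤ v i) × (countFin n (λ w → isYes (c w ≟ i)) ≡ v i)

EdgesOfKv : ∀ {t n} (c : Fin n → Fin t) → EdgeSet n → Set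
EdgesOfKv {t} {n} c E = Symmetric E × ((i j : Fin n) → E ⟪ i , j ⟫ ≡ true → c i ≢ c j)

Subgraph : ℕ → Set
Subgraph n = VSet n × EdgeSet n

-- (W , F) is an E-subgraph of K(v): it is a complete multipartite graph
-- with k ≥ 2 nonempty parts (part of w ∈ W given by p w), each part is
-- contained in a part of K(v), and every edge of it belongs to E.
IsESubgraph : ∀ {t n} (c : Fin n → Fin t) (E : EdgeSet n) → Subgraph n → Set
IsESubgraph {t} {n} c E (W , F) =
  Σ ℕ λ k →
  Σ (Fin n → Fin k) λ p →
      (2 ≤ k)
    × ((a : Fin k) → ∃ λ w → w ∈ᵥ W × p w ≡ a)
    × ((w w′ : Fin n) → w ∈ᵥ W → w′ ∈ᵥ W → p w ≡ p w′ → c w ≡ c w′)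
    × ((i j : Fin n) → F ⟪ i , j ⟫ ≡ true → (i ∈ᵥ W × j ∈ᵥ W × p i ≢ p j))
    × ((i j : Fin n) → i ∈ᵥ W → j ∈ᵥ W → p i ≢ p j → F ⟪ i , j ⟫ ≡ true)
    × (F ⊆ₑ E)

VertexDisjoint : ∀ {n} → Subgraph n → Subgraph n → Set
VertexDisjoint {n} (W₁ , _) (W₂ , _) = (w : Fin n) → ¬ (w ∈ᵥ W₁ × w ∈ᵥ W₂)

-- A garland: a nonempty set of pairwise vertex-disjoint E-subgraphs,
-- given by a list of its members (order irrelevant, see _≈ᵍ_).
IsGarland : ∀ {t n} (c : Fin n → Fin t) (E : EdgeSet n) → List (Subgraph n) → Set
IsGarland c E []        = ⊥
IsGarland c E gs@(_ ∷ _) = All (IsESubgraph c E) gs × AllPairs VertexDisjoint gs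

_≈ᵍ_ : ∀ {n} → List (Subgraph n) → List (Subgraph n) → Set
_≈ᵍ_ {n} g h = (H : Subgraph n) → (H ∈ g → H ∈ h) × (H ∈ h → H ∈ g)

aggregate : ∀ {n} → List (Subgraph n) → Fin n → Fin n → Bool
aggregate []             i j = false
aggregate ((_ , F) ∷ gs) i j = F ⟪ i , j ⟫ ∨ aggregate gs i j

Empty : ∀ {n} → EdgeSet n → Set
Empty {n} M = (i j : Fin n) → M ⟪ i , j ⟫ ≡ false

-- E₂ ⊆ E₁ is continuable outside of E₁ (w.r.t. E): E₂ = E′ ∩ E₁ for the
-- edge aggregate E′ of some garland; the empty set is continuable by convention.
Continuable : ∀ {t n} (c : Fin n → Fin t) (E E₁ E₂ : EdgeSet n) → Set
Continuable {t} {n} c E E₁ E₂ =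
  (E₂ ⊆ₑ E₁) ×
  (Empty E₂ ⊎ (Σ (List (Subgraph n)) λ g → IsGarland c E g ×
                 ((i j : Fin n) → E₂ ⟪ i , j ⟫ ≡ (aggregate g i j ∧ E₁ ⟪ i , j ⟫))))

-- "the number of X's is at most m" for a finite family given up to an
-- equivalence: every list of pairwise inequivalent X's has length ≤ m.
AtMost : {A : Set} (P : A → Set) (_≈_ : A → A → Set) → ℕ → Set
AtMost {A} P _≈_ m = (xs : List A) → All P xs → AllPairs (λ x y → ¬ (x ≈ y)) xs → length xs ≤ m

module Submission where

-- Encode a garland g by its edge aggregate X = aggregate g, and encode X by
-- the pair (X ∩ E₁ , bits of X on the |E| - |E₁| edges of E outside E₁).
--  * The trace X ∩ E₁ is continuable by definition, so the codes range over a set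
--    of at most N · 2 ^ (|E| - |E₁|) elements.
--  * Symmetric relations inside E are determined by their code, and a garland is
--    determined (as a set of subgraphs) by its aggregate: a member H of one garland
--    shares an edge with a member H′ of the other, and the complete multipartite
--    structure forces H = H′.
--  * The empty relation has an admissible code which no garland attains.

open import Defs
open import Data.Nat using (ℕ; zero; suc; _+_; _*_; _∸_; _^_; _≤_; _<_; _<ᵇ_; z≤n; s≤s)
open import Data.Nat.Properties using (+-commutativeSemigroup; m+n∸m≡n; <⇒<ᵇ; <-cmp; +-suc; +-mono-≤; suc-injective; module ≤-Reasoning)
open import Data.Bool using (Bool; true; false; _∧_; _∨_; not; if_then_else_)
open import Data.Fin using (Fin; zero; suc; toℕ; _≟_)
open import Data.Fin.Properties using (toℕ-injective; 0≢1+n)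
open import Data.Vec using (Vec; lookup; tabulate)
open import Data.Vec.Properties using (≡-dec; lookup∘tabulate; tabulate∘lookup; tabulate-cong)
import Data.Bool.Properties as Boolₚ
open import Data.List using (List; []; _∷_; length; map; filter; _++_)
open import Data.List.Properties using (length-map; length-++; ∷-injective)
open import Data.List.Membership.Propositional using (_∈_)
open import Data.List.Relation.Unary.Any using (here; there)
open import Data.List.Relation.Unary.All as All using (All; []; _∷_)
import Data.List.Relation.Unary.All.Properties as Allₚ
open import Data.List.Relation.Unary.AllPairs using (AllPairs; []; _∷_)
import Data.List.Relation.Unary.AllPairs.Properties as AllPairsₚ
open import Data.Product using (∃; _×_; _,_; proj₁; proj₂)
open import Data.Empty using (⊥; ⊥-elim)
open import Data.Sum using (inj₁; inj₂)
open import Data.Unit using (⊤; tt)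
open import Function using (_∘_; Equivalence; mk⇔)
open import Relation.Nullary using (¬_; ¬?; Dec; yes; no)
open import Relation.Unary using (Decidable)
open import Relation.Binary.Definitions using (DecidableEquality; tri<; tri≈; tri>)
open import Relation.Binary.PropositionalEquality
open import Algebra.Properties.CommutativeSemigroup +-commutativeSemigroup
  using () renaming (interchange to +-interchange)

length-filter-split : {A : Set} {P : A → Set} (P? : Decidable P) (xs : List A) →
                      length xs ≡ length (filter P? xs) + length (filter (¬? ∘ P?) xs)
length-filter-split P? [] = refl
length-filter-split P? (x ∷ xs) with P? x
... | yes _ = cong suc (length-filter-split P? xs)
... | no _  = trans (cong suc (length-filter-split P? xs)) (sym (+-suc _ _))

AtMost-remove : {B : Set} {R : B → Set} {K : ℕ} (b₀ : B) → R b₀ → AtMost R _≡_ K →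
                AtMost (λ b → R b × b ≢ b₀) _≡_ (K ∸ 1)
AtMost-remove b₀ Rb₀ bound bs Rbs distinct =
  pred-bound (bound (b₀ ∷ bs) (Rb₀ ∷ All.map proj₁ Rbs)
                    (All.map (λ Rb≢ b₀≡b → proj₂ Rb≢ (sym b₀≡b)) Rbs ∷ distinct))
  where
  pred-bound : ∀ {a K} → suc a ≤ K → a ≤ K ∸ 1
  pred-bound (s≤s a≤K) = a≤K

AtMost-map : {A B : Set} {P : A → Set} {_≈_ : A → A → Set} {R : B → Set} {K : ℕ}
             (f : A → B) → (∀ {a} → P a → R (f a)) →
             (∀ {a a′} → P a → P a′ → f a ≡ f a′ → a ≈ a′) →
             AtMost R _≡_ K → AtMost P _≈_ K
AtMost-map {P = P} {_≈_} {K = K} f maps reflects bound xs Pxs distinct =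
  subst (_≤ K) (length-map f xs)
        (bound (map f xs) (Allₚ.map⁺ (All.map maps Pxs)) (distinct-image Pxs distinct))
  where
  distinct-image : ∀ {xs} → All P xs → AllPairs (λ x y → ¬ x ≈ y) xs →
                   AllPairs (λ x y → ¬ x ≡ y) (map f xs)
  distinct-image [] [] = []
  distinct-image (Px ∷ Pxs) (x≉xs ∷ distinct) =
    Allₚ.map⁺ (All.zipWith (λ { (Py , x≉y) fx≡fy → x≉y (reflects Px Py fx≡fy) }) (Pxs , x≉xs))
    ∷ distinct-image Pxs distinct

-- Induction on the bound for P: the pairs sharing the first coordinate y₀ of the
-- first pair are at most M many, the remaining ones avoid y₀.
AtMost-× : {Y Z : Set} → DecidableEquality Y → {P : Y → Set} {Q : Z → Set} {N M : ℕ} →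
           AtMost P _≡_ N → AtMost Q _≡_ M →
           AtMost (λ x → P (proj₁ x) × Q (proj₂ x)) _≡_ (N * M)
AtMost-× _≟_ boundP boundQ [] _ _ = z≤n
AtMost-× _≟_ {N = zero} boundP boundQ ((y , _) ∷ _) ((Py , _) ∷ _) _
  with () ← boundP (y ∷ []) (Py ∷ []) ([] ∷ [])
AtMost-× {Y} {Z} _≟_ {P} {Q} {suc N} {M} boundP boundQ
         ((y₀ , z₀) ∷ xs) ((Py₀ , Qz₀) ∷ PQxs) (x₀∉xs ∷ distinct) =
  begin
    suc (length xs)                                   ≡⟨ cong suc (length-filter-split at-y₀? xs) ⟩
    suc (length (filter at-y₀? xs)) + length others   ≤⟨ +-mono-≤ fibre-bound others-bound ⟩
    M + N * M                                         ∎
  where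
  open ≤-Reasoning
  at-y₀? : (x : Y × Z) → Dec (proj₁ x ≡ y₀)
  at-y₀? x = proj₁ x ≟ y₀
  others : List (Y × Z)
  others = filter (¬? ∘ at-y₀?) xs
  -- on the fibre over y₀ the second projection is injective
  fibre-bound : suc (length (filter at-y₀? xs)) ≤ M
  fibre-bound = AtMost-map {P = λ x → proj₁ x ≡ y₀ × Q (proj₂ x)} proj₂ proj₂
    (λ { {_ , _} {_ , _} (refl , _) (refl , _) refl → refl }) boundQ
    ((y₀ , z₀) ∷ filter at-y₀? xs)
    ((refl , Qz₀) ∷ All.zip (Allₚ.all-filter at-y₀? xs , Allₚ.filter⁺ at-y₀? (All.map proj₂ PQxs)))
    (Allₚ.filter⁺ at-y₀? x₀∉xs ∷ AllPairsₚ.filter⁺ at-y₀? distinct)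
  others-bound : length others ≤ N * M
  others-bound = AtMost-× _≟_ {N = N} (AtMost-remove y₀ Py₀ boundP) boundQ others
    (All.zipWith (λ { ((Py , Qz) , y≢y₀) → (Py , y≢y₀) , Qz })
                 (Allₚ.filter⁺ (¬? ∘ at-y₀?) PQxs , Allₚ.all-filter (¬? ∘ at-y₀?) xs))
    (AllPairsₚ.filter⁺ (¬? ∘ at-y₀?) distinct)

AtMost-Bool : AtMost {Bool} (λ _ → ⊤) _≡_ 2
AtMost-Bool []               _ _ = z≤n
AtMost-Bool (_ ∷ [])         _ _ = s≤s z≤n
AtMost-Bool (_ ∷ _ ∷ [])     _ _ = s≤s (s≤s z≤n)
AtMost-Bool (x ∷ y ∷ z ∷ _) _ ((x≢y ∷ x≢z ∷ _) ∷ (y≢z ∷ _) ∷ _) = ⊥-elim (pigeonhole x y z x≢y x≢z y≢z)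
  where
  pigeonhole : ∀ x y z → x ≢ y → x ≢ z → y ≢ z → ⊥
  pigeonhole false false _     x≢y _   _   = x≢y refl
  pigeonhole true  true  _     x≢y _   _   = x≢y refl
  pigeonhole false true  false _   x≢z _   = x≢z refl
  pigeonhole true  false true  _   x≢z _   = x≢z refl
  pigeonhole false true  true  _   _   y≢z = y≢z refl
  pigeonhole true  false false _   _   y≢z = y≢z refl

AtMost-bits : ∀ m → AtMost (λ (bs : List Bool) → length bs ≡ m) _≡_ (2 ^ m)
AtMost-bits zero    []                 _               _                = z≤n
AtMost-bits zero    (_ ∷ [])           _               _                = s≤s z≤n
AtMost-bits zero    ([] ∷ [] ∷ _)      _               ((≢[] ∷ _) ∷ _) = ⊥-elim (≢[] refl)
AtMost-bits zero    ((_ ∷ _) ∷ _ ∷ _) (() ∷ _)        _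
AtMost-bits zero    ([] ∷ (_ ∷ _) ∷ _) (_ ∷ () ∷ _)   _
AtMost-bits (suc m) =
  AtMost-map uncons (λ {bs} → uncons-length bs) (λ {bs} {bs′} → uncons-injective bs bs′)
             (AtMost-× Boolₚ._≟_ AtMost-Bool (AtMost-bits m))
  where
  uncons : List Bool → Bool × List Bool
  uncons []       = false , []
  uncons (b ∷ bs) = b , bs
  uncons-length : ∀ bs → length bs ≡ suc m → ⊤ × length (proj₂ (uncons bs)) ≡ m
  uncons-length (_ ∷ _) len = tt , suc-injective len
  uncons-injective : ∀ bs bs′ → length bs ≡ suc m → length bs′ ≡ suc m →
                     uncons bs ≡ uncons bs′ → bs ≡ bs′
  uncons-injective (_ ∷ _) (_ ∷ _) _ _ refl = refl

restrict : (k : ℕ) → (Fin k → Bool) → (Fin k → Bool) → List Bool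
restrict zero    p f = []
restrict (suc k) p f with p zero
... | true  = f zero ∷ restrict k (p ∘ suc) (f ∘ suc)
... | false = restrict k (p ∘ suc) (f ∘ suc)

length-restrict : ∀ k p f → length (restrict k p f) ≡ countFin k p
length-restrict zero    p f = refl
length-restrict (suc k) p f with p zero
... | true  = cong suc (length-restrict k (p ∘ suc) (f ∘ suc))
... | false = length-restrict k (p ∘ suc) (f ∘ suc)

restrict-injective : ∀ k p f f′ → restrict k p f ≡ restrict k p f′ →
                     ∀ i → p i ≡ true → f i ≡ f′ i
restrict-injective (suc k) p f f′ eq i pi with p zero in p₀
restrict-injective (suc k) p f f′ eq zero    pi | true = proj₁ (∷-injective eq)
restrict-injective (suc k) p f f′ eq (suc i) pi | true =
  restrict-injective k (p ∘ suc) (f ∘ suc) (f′ ∘ suc) (proj₂ (∷-injective eq)) i pi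
restrict-injective (suc k) p f f′ eq zero    pi | false with () ← trans (sym p₀) pi
restrict-injective (suc k) p f f′ eq (suc i) pi | false =
  restrict-injective k (p ∘ suc) (f ∘ suc) (f′ ∘ suc) eq i pi

concatFin : {A : Set} (k : ℕ) → (Fin k → List A) → List A
concatFin zero    r = []
concatFin (suc k) r = r zero ++ concatFin k (r ∘ suc)

length-concatFin : {A : Set} (k : ℕ) (r : Fin k → List A) →
                   length (concatFin k r) ≡ sumFin k (length ∘ r)
length-concatFin zero    r = refl
length-concatFin (suc k) r =
  trans (length-++ (r zero)) (cong (length (r zero) +_) (length-concatFin k (r ∘ suc)))

++-injective : {A : Set} (xs xs′ ys ys′ : List A) → length xs ≡ length xs′ →
               xs ++ ys ≡ xs′ ++ ys′ → xs ≡ xs′ × ys ≡ ys′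
++-injective []       []         ys ys′ _   eq = refl , eq
++-injective (x ∷ xs) (x′ ∷ xs′) ys ys′ len eq with refl , eq′ ← ∷-injective eq
  with refl , refl ← ++-injective xs xs′ ys ys′ (suc-injective len) eq′ = refl , refl

concatFin-injective : {A : Set} (k : ℕ) (r r′ : Fin k → List A) →
                      (∀ i → length (r i) ≡ length (r′ i)) → concatFin k r ≡ concatFin k r′ → ∀ i → r i ≡ r′ i
concatFin-injective (suc k) r r′ len eq i
  with ++-injective (r zero) (r′ zero) _ _ (len zero) eq
concatFin-injective (suc k) r r′ len eq zero    | head-eq , _ = head-eq
concatFin-injective (suc k) r r′ len eq (suc i) | _ , tail-eq =
  concatFin-injective k (r ∘ suc) (r′ ∘ suc) (len ∘ suc) tail-eq i

count-cong : ∀ k (p q : Fin k → Bool) → (∀ i → p i ≡ q i) → countFin k p ≡ countFin k q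
count-cong zero    p q p≗q = refl
count-cong (suc k) p q p≗q = cong₂ (λ b rest → (if b then 1 else 0) + rest)
                                   (p≗q zero) (count-cong k (p ∘ suc) (q ∘ suc) (p≗q ∘ suc))

sum-cong : ∀ k (f g : Fin k → ℕ) → (∀ i → f i ≡ g i) → sumFin k f ≡ sumFin k g
sum-cong zero    f g f≗g = refl
sum-cong (suc k) f g f≗g = cong₂ _+_ (f≗g zero) (sum-cong k (f ∘ suc) (g ∘ suc) (f≗g ∘ suc))

sum-+ : ∀ k (f g : Fin k → ℕ) → sumFin k (λ i → f i + g i) ≡ sumFin k f + sumFin k g
sum-+ zero    f g = refl
sum-+ (suc k) f g = begin
  f zero + g zero + sumFin k (λ i → f (suc i) + g (suc i))
    ≡⟨ cong (f zero + g zero +_) (sum-+ k (f ∘ suc) (g ∘ suc)) ⟩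
  f zero + g zero + (sumFin k (f ∘ suc) + sumFin k (g ∘ suc))
    ≡⟨ +-interchange (f zero) (g zero) _ _ ⟩
  f zero + sumFin k (f ∘ suc) + (g zero + sumFin k (g ∘ suc))
    ∎
  where open ≡-Reasoning

count-split : ∀ k (p q : Fin k → Bool) →
              countFin k p ≡ countFin k (λ i → p i ∧ q i) + countFin k (λ i → p i ∧ not (q i))
count-split zero    p q = refl
count-split (suc k) p q with p zero | q zero
... | false | _     = count-split k (p ∘ suc) (q ∘ suc)
... | true  | true  = cong suc (count-split k (p ∘ suc) (q ∘ suc))
... | true  | false = trans (cong suc (count-split k (p ∘ suc) (q ∘ suc))) (sym (+-suc _ _))

BoolRel : ℕ → Set
BoolRel n = Fin n → Fin n → Bool

SymmetricRel : ∀ {n} → BoolRel n → Set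
SymmetricRel {n} X = ∀ (i j : Fin n) → X i j ≡ X j i

_⊆ᵣ_ : ∀ {n} → BoolRel n → EdgeSet n → Set
_⊆ᵣ_ {n} X M = ∀ (i j : Fin n) → X i j ≡ true → M ⟪ i , j ⟫ ≡ true

-- Encoding a symmetric relation X ⊆ E by its trace X ∩ E₁ together with the bit
-- string of its values on the pairs i < j that are edges of E outside E₁.
module Encoding {n : ℕ} (E E₁ : EdgeSet n) where

  outside : BoolRel n
  outside i j = ((toℕ i <ᵇ toℕ j) ∧ E ⟪ i , j ⟫) ∧ not (E₁ ⟪ i , j ⟫)

  #outside : ℕ
  #outside = sumFin n (λ i → countFin n (outside i))

  #outside≡ : E₁ ⊆ₑ E → #outside ≡ ∣ E ∣ₑ ∸ ∣ E₁ ∣ₑ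
  #outside≡ E₁⊆E = begin
    #outside                        ≡⟨ m+n∸m≡n ∣ E₁ ∣ₑ #outside ⟨
    ∣ E₁ ∣ₑ + #outside ∸ ∣ E₁ ∣ₑ    ≡⟨ cong (_∸ ∣ E₁ ∣ₑ) edges-split ⟨
    ∣ E ∣ₑ ∸ ∣ E₁ ∣ₑ                ∎
    where
    open ≡-Reasoning
    upper : BoolRel n
    upper i j = toℕ i <ᵇ toℕ j
    inside : ∀ i j → (upper i j ∧ E ⟪ i , j ⟫) ∧ E₁ ⟪ i , j ⟫ ≡ upper i j ∧ E₁ ⟪ i , j ⟫
    inside i j with E₁ ⟪ i , j ⟫ in e₁
    ... | false = trans (Boolₚ.∧-zeroʳ _) (sym (Boolₚ.∧-zeroʳ _))
    ... | true rewrite E₁⊆E i j e₁ = cong (_∧ true) (Boolₚ.∧-identityʳ (upper i j))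
    edges-split : ∣ E ∣ₑ ≡ ∣ E₁ ∣ₑ + #outside
    edges-split = begin
      ∣ E ∣ₑ
        ≡⟨ sum-cong n _ _ (λ i → count-split n _ (λ j → E₁ ⟪ i , j ⟫)) ⟩
      sumFin n (λ i → countFin n (λ j → (upper i j ∧ E ⟪ i , j ⟫) ∧ E₁ ⟪ i , j ⟫) + countFin n (outside i))
        ≡⟨ sum-+ n _ _ ⟩
      sumFin n (λ i → countFin n (λ j → (upper i j ∧ E ⟪ i , j ⟫) ∧ E₁ ⟪ i , j ⟫)) + #outside
        ≡⟨ cong (_+ #outside) (sum-cong n _ _ (λ i → count-cong n _ _ (inside i))) ⟩
      ∣ E₁ ∣ₑ + #outside
        ∎

  trace : BoolRel n → EdgeSet n
  trace X = tabulate (λ i → tabulate (λ j → X i j ∧ E₁ ⟪ i , j ⟫))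

  trace-lookup : ∀ X i j → trace X ⟪ i , j ⟫ ≡ X i j ∧ E₁ ⟪ i , j ⟫
  trace-lookup X i j = trans (cong (λ row → lookup row j) (lookup∘tabulate _ i)) (lookup∘tabulate _ j)

  trace-⊆ : ∀ X → trace X ⊆ₑ E₁
  trace-⊆ X i j inTrace = right-conjunct (X i j) (trans (sym (trace-lookup X i j)) inTrace)
    where
    right-conjunct : ∀ a {b} → a ∧ b ≡ true → b ≡ true
    right-conjunct true b≡true = b≡true

  outsideBits : BoolRel n → List Bool
  outsideBits X = concatFin n (λ i → restrict n (outside i) (X i))

  length-outsideBits : ∀ X → length (outsideBits X) ≡ #outside
  length-outsideBits X =
    trans (length-concatFin n _) (sum-cong n _ _ (λ i → length-restrict n (outside i) (X i)))

  encode : BoolRel n → EdgeSet n × List Bool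
  encode X = trace X , outsideBits X

  encode-injective-upper : ∀ X Y → encode X ≡ encode Y → ∀ i j →
                           toℕ i < toℕ j → E ⟪ i , j ⟫ ≡ true → X i j ≡ Y i j
  encode-injective-upper X Y eq i j i<j ij∈E with E₁ ⟪ i , j ⟫ in e₁
  ... | true  = begin
    X i j              ≡⟨ Boolₚ.∧-identityʳ (X i j) ⟨
    X i j ∧ true       ≡⟨ subst (λ b → X i j ∧ b ≡ Y i j ∧ b) e₁ same-trace ⟩
    Y i j ∧ true       ≡⟨ Boolₚ.∧-identityʳ (Y i j) ⟩
    Y i j              ∎
    where
    open ≡-Reasoning
    same-trace : X i j ∧ E₁ ⟪ i , j ⟫ ≡ Y i j ∧ E₁ ⟪ i , j ⟫
    same-trace = trans (sym (trace-lookup X i j))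
                       (trans (cong (λ T → T ⟪ i , j ⟫) (cong proj₁ eq)) (trace-lookup Y i j))
  ... | false = restrict-injective n (outside i) (X i) (Y i) same-row j is-outside
    where
    same-row : restrict n (outside i) (X i) ≡ restrict n (outside i) (Y i)
    same-row = concatFin-injective n _ _
      (λ k → trans (length-restrict n (outside k) (X k)) (sym (length-restrict n (outside k) (Y k))))
      (cong proj₂ eq) i
    is-outside : outside i j ≡ true
    is-outside rewrite Equivalence.to Boolₚ.T-≡ (<⇒<ᵇ i<j) | ij∈E | e₁ = refl

  encode-injective : Symmetric E → (∀ i → E ⟪ i , i ⟫ ≢ true) → ∀ X Y →
                     SymmetricRel X → SymmetricRel Y → X ⊆ᵣ E → Y ⊆ᵣ E →
                     encode X ≡ encode Y → ∀ i j → X i j ≡ Y i j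
  encode-injective E-sym E-loopless X Y X-sym Y-sym X⊆E Y⊆E eq i j with E ⟪ i , j ⟫ in ij∈E
  ... | false = trans (vanishes X X⊆E ij∈E) (sym (vanishes Y Y⊆E ij∈E))
    where
    vanishes : ∀ Z → Z ⊆ᵣ E → E ⟪ i , j ⟫ ≡ false → Z i j ≡ false
    vanishes Z Z⊆E ij∉E with Z i j in z
    ... | false = refl
    ... | true  = trans (sym (Z⊆E i j z)) ij∉E
  ... | true with <-cmp (toℕ i) (toℕ j)
  ... | tri< i<j _ _ = encode-injective-upper X Y eq i j i<j ij∈E
  ... | tri≈ _ i≡j _ with refl ← toℕ-injective i≡j = ⊥-elim (E-loopless i ij∈E)
  ... | tri> _ _ j<i = begin
    X i j  ≡⟨ X-sym i j ⟩
    X j i  ≡⟨ encode-injective-upper X Y eq j i j<i (trans (E-sym j i) ij∈E) ⟩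
    Y j i  ≡⟨ Y-sym j i ⟩
    Y i j  ∎
    where open ≡-Reasoning

lookup-ext : {A : Set} {k : ℕ} (v w : Vec A k) → (∀ i → lookup v i ≡ lookup w i) → v ≡ w
lookup-ext v w same = trans (sym (tabulate∘lookup v)) (trans (tabulate-cong same) (tabulate∘lookup w))

subgraph-antisym : ∀ {n} {W W′ : VSet n} {F F′ : EdgeSet n} →
                   (∀ x → x ∈ᵥ W → x ∈ᵥ W′) → F ⊆ₑ F′ → (∀ x → x ∈ᵥ W′ → x ∈ᵥ W) → F′ ⊆ₑ F →
                   (W , F) ≡ (W′ , F′)
subgraph-antisym W⊆W′ F⊆F′ W′⊆W F′⊆F =
  cong₂ _,_ (lookup-ext _ _ (λ x → Boolₚ.⇔→≡ (mk⇔ (W⊆W′ x) (W′⊆W x))))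
            (lookup-ext _ _ (λ i → lookup-ext _ _ (λ j → Boolₚ.⇔→≡ (mk⇔ (F⊆F′ i j) (F′⊆F i j)))))

disjoint-unique : ∀ {n} {gs : List (Subgraph n)} {H H′ : Subgraph n} {x : Fin n} →
                  AllPairs VertexDisjoint gs → H ∈ gs → H′ ∈ gs →
                  x ∈ᵥ proj₁ H → x ∈ᵥ proj₁ H′ → H ≡ H′
disjoint-unique (_ ∷ _) (here refl) (here refl) _ _ = refl
disjoint-unique {x = x} (H∩ ∷ _) (here refl) (there H′∈) x∈H x∈H′ =
  ⊥-elim (All.lookup H∩ H′∈ x (x∈H , x∈H′))
disjoint-unique {x = x} (H∩ ∷ _) (there H∈) (here refl) x∈H x∈H′ =
  ⊥-elim (All.lookup H∩ H∈ x (x∈H′ , x∈H))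
disjoint-unique (_ ∷ disjoint) (there H∈) (there H′∈) x∈H x∈H′ =
  disjoint-unique disjoint H∈ H′∈ x∈H x∈H′

∈-aggregate : ∀ {n} {gs : List (Subgraph n)} {H : Subgraph n} i j →
              H ∈ gs → proj₂ H ⟪ i , j ⟫ ≡ true → aggregate gs i j ≡ true
∈-aggregate i j (here refl) ij∈H rewrite ij∈H = refl
∈-aggregate {gs = (_ , F) ∷ gs} i j (there H∈) ij∈H
  rewrite ∈-aggregate {gs = gs} i j H∈ ij∈H = Boolₚ.∨-zeroʳ (F ⟪ i , j ⟫)

aggregate-∈ : ∀ {n} (gs : List (Subgraph n)) i j → aggregate gs i j ≡ true →
              ∃ λ H → H ∈ gs × proj₂ H ⟪ i , j ⟫ ≡ true
aggregate-∈ ((W , F) ∷ gs) i j ij∈agg with F ⟪ i , j ⟫ in ij∈F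
... | true  = (W , F) , here refl , ij∈F
... | false with H , H∈ , ij∈H ← aggregate-∈ gs i j ij∈agg = H , there H∈ , ij∈H

module Garlands {t n : ℕ} (c : Fin n → Fin t) (E : EdgeSet n) where

  edge-ends : ∀ {W F} → IsESubgraph c E (W , F) → ∀ i j → F ⟪ i , j ⟫ ≡ true → i ∈ᵥ W × j ∈ᵥ W
  edge-ends (_ , _ , _ , _ , _ , ends , _) i j ij∈F with i∈W , j∈W , _ ← ends i j ij∈F = i∈W , j∈W

  -- An E-subgraph is symmetric: its edges are the pairs of its vertices in different parts.
  subgraph-symmetric : ∀ {W F} → IsESubgraph c E (W , F) → Symmetric F
  subgraph-symmetric {F = F} (_ , _ , _ , _ , _ , ends , complete , _) i j =
    Boolₚ.⇔→≡ (mk⇔ (reverse i j) (reverse j i))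
    where
    reverse : ∀ i j → F ⟪ i , j ⟫ ≡ true → F ⟪ j , i ⟫ ≡ true
    reverse i j ij∈F with i∈W , j∈W , parts≢ ← ends i j ij∈F = complete j i j∈W i∈W (parts≢ ∘ sym)

  -- An E-subgraph has at least two parts, hence an edge.
  subgraph-has-edge : ∀ {W F} → IsESubgraph c E (W , F) → ∃ λ w → ∃ λ u → F ⟪ w , u ⟫ ≡ true
  subgraph-has-edge (suc zero    , _ , s≤s () , _)
  subgraph-has-edge (suc (suc k) , part , _ , onto , _ , _ , complete , _)
    with w , w∈W , part-w ← onto zero | u , u∈W , part-u ← onto (suc zero) =
    w , u , complete w u w∈W u∈W (λ same-part → 0≢1+n (trans (sym part-w) (trans same-part part-u)))

  -- A complete multipartite H = (W , F) sharing an edge w u with the E-subgraph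
  -- H′ = (W′ , F′) lies inside H′, provided every edge of H at a vertex of H′ is an
  -- edge of H′: each vertex of H is adjacent in H to w or to u.
  subgraph-inclusion : ∀ {W F W′ F′} → IsESubgraph c E (W , F) → IsESubgraph c E (W′ , F′) →
                       ∀ {w u} → F ⟪ w , u ⟫ ≡ true → F′ ⟪ w , u ⟫ ≡ true →
                       (∀ x y → x ∈ᵥ W′ → F ⟪ x , y ⟫ ≡ true → F′ ⟪ x , y ⟫ ≡ true) →
                       (∀ x → x ∈ᵥ W → x ∈ᵥ W′) × F ⊆ₑ F′
  subgraph-inclusion {W} {F} {W′} {F′} H@(_ , part , _ , _ , _ , ends , complete , _) H′
                     {w} {u} wu∈F wu∈F′ extends =
    W⊆W′ , λ x y xy∈F → extends x y (W⊆W′ x (proj₁ (edge-ends {W} {F} H x y xy∈F))) xy∈F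
    where
    via : ∀ {a x} → a ∈ᵥ W → a ∈ᵥ W′ → x ∈ᵥ W → part x ≢ part a → x ∈ᵥ W′
    via {a} {x} a∈W a∈W′ x∈W parts≢ =
      proj₂ (edge-ends {W′} {F′} H′ a x (extends a x a∈W′ (complete a x a∈W x∈W (parts≢ ∘ sym))))
    W⊆W′ : ∀ x → x ∈ᵥ W → x ∈ᵥ W′
    W⊆W′ x x∈W with w∈W , u∈W , w≢u ← ends w u wu∈F
                  | w∈W′ , u∈W′ ← edge-ends {W′} {F′} H′ w u wu∈F′
      with part x ≟ part w
    ... | no  x≢w = via w∈W w∈W′ x∈W x≢w
    ... | yes x≡w = via u∈W u∈W′ x∈W (w≢u ∘ trans (sym x≡w))

  aggregate-symmetric : ∀ {gs} → All (IsESubgraph c E) gs → SymmetricRel (aggregate gs)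
  aggregate-symmetric []                     i j = refl
  aggregate-symmetric {(W , F) ∷ _} (H ∷ Hs) i j =
    cong₂ _∨_ (subgraph-symmetric {W} {F} H i j) (aggregate-symmetric Hs i j)

  aggregate-⊆ : ∀ {gs} → All (IsESubgraph c E) gs → aggregate gs ⊆ᵣ E
  aggregate-⊆ {gs} Hs i j ij∈agg
    with (W , F) , H∈ , ij∈F ← aggregate-∈ gs i j ij∈agg
    with (_ , _ , _ , _ , _ , _ , _ , F⊆E) ← All.lookup Hs H∈ = F⊆E i j ij∈F

  aggregate-at-member : ∀ {gs W′ F′ x y} → All (IsESubgraph c E) gs → AllPairs VertexDisjoint gs →
                        (W′ , F′) ∈ gs → x ∈ᵥ W′ → aggregate gs x y ≡ true → F′ ⟪ x , y ⟫ ≡ true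
  aggregate-at-member {gs} {x = x} {y} Hs disjoint H′∈ x∈W′ xy∈agg
    with (W , F) , H∈ , xy∈F ← aggregate-∈ gs x y xy∈agg
    with refl ← disjoint-unique disjoint H∈ H′∈
                  (proj₁ (edge-ends {W} {F} (All.lookup Hs H∈) x y xy∈F)) x∈W′
    = xy∈F

  -- Two garlands with the same edge aggregate have the same members.
  -- A member H of g shares an edge with some member H′ of h; by subgraph-inclusion
  -- in both directions H = H′.
  same-aggregate-⊆ : ∀ {g h} → All (IsESubgraph c E) g → All (IsESubgraph c E) h →
                     AllPairs VertexDisjoint g → AllPairs VertexDisjoint h →
                     (∀ i j → aggregate g i j ≡ aggregate h i j) → ∀ H → H ∈ g → H ∈ h
  same-aggregate-⊆ {g} {h} Hs-g Hs-h disjoint-g disjoint-h same (W , F) H∈g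
    with w , u , wu∈F ← subgraph-has-edge {W} {F} (All.lookup Hs-g H∈g)
    with (W′ , F′) , H′∈h , wu∈F′ ← aggregate-∈ h w u (trans (sym (same w u)) (∈-aggregate w u H∈g wu∈F))
    with W⊆W′ , F⊆F′ ← subgraph-inclusion {W} {F} {W′} {F′}
                         (All.lookup Hs-g H∈g) (All.lookup Hs-h H′∈h) wu∈F wu∈F′
           (λ x y x∈W′ xy∈F → aggregate-at-member Hs-h disjoint-h H′∈h x∈W′
                                 (trans (sym (same x y)) (∈-aggregate x y H∈g xy∈F)))
    with W′⊆W , F′⊆F ← subgraph-inclusion {W′} {F′} {W} {F}
                         (All.lookup Hs-h H′∈h) (All.lookup Hs-g H∈g) wu∈F′ wu∈F
           (λ x y x∈W xy∈F′ → aggregate-at-member Hs-g disjoint-g H∈g x∈W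
                                 (trans (same x y) (∈-aggregate x y H′∈h xy∈F′)))
    = subst (_∈ h) (sym (subgraph-antisym W⊆W′ F⊆F′ W′⊆W F′⊆F)) H′∈h

  garland-parts : ∀ {g} → IsGarland c E g → All (IsESubgraph c E) g × AllPairs VertexDisjoint g
  garland-parts {_ ∷ _} parts = parts

  garland-determined : ∀ {g h} → IsGarland c E g → IsGarland c E h →
                       (∀ i j → aggregate g i j ≡ aggregate h i j) → g ≈ᵍ h
  garland-determined G H same K =
    same-aggregate-⊆ Hs-g Hs-h disjoint-g disjoint-h same K ,
    same-aggregate-⊆ Hs-h Hs-g disjoint-h disjoint-g (λ i j → sym (same i j)) K
    where
    Hs-g = proj₁ (garland-parts G)
    disjoint-g = proj₂ (garland-parts G)
    Hs-h = proj₁ (garland-parts H)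
    disjoint-h = proj₂ (garland-parts H)

  garland-has-edge : ∀ {g} → IsGarland c E g → ∃ λ i → ∃ λ j → aggregate g i j ≡ true
  garland-has-edge {(W , F) ∷ g} (H ∷ _ , _)
    with w , u , wu∈F ← subgraph-has-edge {W} {F} H =
    w , u , ∈-aggregate {gs = (W , F) ∷ g} w u (here refl) wu∈F

module GarlandCodes {t n : ℕ} (c : Fin n → Fin t) (E E₁ : EdgeSet n)
                    (E-sym : Symmetric E) (E-loopless : ∀ i → E ⟪ i , i ⟫ ≢ true) where

  open Encoding E E₁ public
  open Garlands c E

  Admissible : EdgeSet n × List Bool → Set
  Admissible code = Continuable c E E₁ (proj₁ code) × length (proj₂ code) ≡ #outside

  no-edges : BoolRel n
  no-edges _ _ = false

  empty-code-admissible : Admissible (encode no-edges)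
  empty-code-admissible = (trace-⊆ no-edges , inj₁ (trace-lookup no-edges)) , length-outsideBits no-edges

  garland-code : ∀ {g} → IsGarland c E g →
                 Admissible (encode (aggregate g)) × encode (aggregate g) ≢ encode no-edges
  garland-code {g} G =
    ((trace-⊆ (aggregate g) , inj₂ (g , G , trace-lookup (aggregate g))) , length-outsideBits (aggregate g)) ,
    λ same-code → let i , j , ij∈agg = garland-has-edge G in
      true≢false (trans (sym ij∈agg)
        (encode-injective E-sym E-loopless (aggregate g) no-edges
           (aggregate-symmetric Hs) (λ _ _ → refl) (aggregate-⊆ Hs) (λ _ _ ()) same-code i j))
    where
    Hs = proj₁ (garland-parts G)
    true≢false : true ≢ false
    true≢false ()

  garland-code-injective : ∀ {g h} → IsGarland c E g → IsGarland c E h →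
                           encode (aggregate g) ≡ encode (aggregate h) → g ≈ᵍ h
  garland-code-injective {g} {h} G H same-code =
    garland-determined G H
      (encode-injective E-sym E-loopless (aggregate g) (aggregate h)
         (aggregate-symmetric Hs-g) (aggregate-symmetric Hs-h)
         (aggregate-⊆ Hs-g) (aggregate-⊆ Hs-h) same-code)
    where
    Hs-g = proj₁ (garland-parts G)
    Hs-h = proj₁ (garland-parts H)

lemma4 : (t : ℕ) (v : Fin t → ℕ) (n : ℕ) (c : Fin n → Fin t) → IsKv t v n c →
         (E E₁ : EdgeSet n) → EdgesOfKv c E → Symmetric E₁ → E₁ ⊆ₑ E →
         (N : ℕ) → AtMost (Continuable c E E₁) _≡_ N →
         AtMost (IsGarland c E) _≈ᵍ_ (N * 2 ^ (∣ E ∣ₑ ∸ ∣ E₁ ∣ₑ) ∸ 1)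
lemma4 t v n c _ E E₁ (E-sym , E-multipartite) _ E₁⊆E N few-continuable =
  subst (λ m → AtMost (IsGarland c E) _≈ᵍ_ (N * 2 ^ m ∸ 1)) (#outside≡ E₁⊆E)
    (AtMost-map (encode ∘ aggregate) garland-code garland-code-injective
      (AtMost-remove (encode no-edges) empty-code-admissible
        (AtMost-× (≡-dec (≡-dec Boolₚ._≟_)) few-continuable (AtMost-bits #outside))))
  where
  open GarlandCodes c E E₁ E-sym (λ i ii∈E → E-multipartite i i ii∈E refl)
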